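{- Let $G$ be an interval graph. A sequence of cliques $\mathcal S$ of $G$ is a clique ordering of $G$ if and only if $\mathcal S$ can be generated from the PQ-tree of $G$.
   Context: All graphs are finite and simple; cliques are allowed to be empty. A clique ordering of $G$ is a finite sequence $Q_1,\dots,Q_l$ of (possibly empty) cliques of $G$ such that every maximal clique of $G$ occurs in the sequence and, for every vertex $v$, the indices $i$ with $v\in Q_i$ form a set of consecutive integers. For a sequence $Q_1,\dots,Q_l$ of cliques of $G$, put $Q_0=Q_{l+1}=\emptyset$; a subclique insertion inserts a clique $Q'$ of $G$ between $Q_i$ and $Q_{i+1}$ for some $i\in\{0,\dots,l\}$, where $Q'\supseteq Q_i\cap Q_{i+1}$ and either $Q'\subseteq Q_i$ or $Q'\subseteq Q_{i+1}$. A PQ-tree is a rooted ordered tree whose internal nodes are P-nodes or Q-nodes (a node with exactly two children is regarded as a Q-node); a leaf order is the left-to-right sequence of leaves obtained after arbitrarily permuting the children of each P-node and optionally reversing the order of the children of each Q-node. The PQ-tree of an interval graph $G$ is the (Booth–Lueker) PQ-tree whose leaves are the maximal cliques of $G$ and whose leaf orders are exactly the orderings of the maximal cliques of $G$ in which, for every vertex $v$, the cliques containing $v$ are consecutive. A sequence of cliques is generated by a PQ-tree whose leaves are cliques of $G$ if it can be obtained from some leaf order of the tree by finitely many (possibly zero) subclique insertions. -}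

module Defs where

open import Level using (0ℓ)
open import Data.Nat as ℕ using (ℕ; _≤_)
open import Data.Nat.Base using (_⊔_; _⊓_)
open import Data.Fin as Fin using (Fin)
open import Data.Fin.Subset as Sub using (Subset; _∩_; _⊆_) renaming (_∈_ to _∈ₛ_; ⊥ to ∅)
open import Data.List as List using (List; []; _∷_; _++_; concat; reverse; length; lookup)
open import Data.List.Membership.Propositional using () renaming (_∈_ to _∈ₗ_)
open import Data.List.Relation.Unary.All using (All)
open import Data.List.Relation.Unary.Unique.Propositional using (Unique)
open import Data.List.Relation.Binary.Permutation.Propositional using (_↭_)
open import Data.Product using (Σ; ∃; ∃-syntax; _×_; _,_; proj₁; proj₂)
open import Data.Sum using (_⊎_)
open import Relation.Binary.PropositionalEquality using (_≡_; _≢_)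
open import Relation.Binary.Construct.Closure.ReflexiveTransitive using (Star)
open import Function.Bundles using (_⇔_)
open import Relation.Nullary using (¬_)

record Graph : Set₁ where
  field
    n     : ℕ
    Adj   : Fin n → Fin n → Set
    sym   : ∀ {u v} → Adj u v → Adj v u
    irrefl : ∀ {v} → ¬ Adj v v

module _ (G : Graph) where
  open Graph G

  IsClique : Subset n → Set
  IsClique Q = ∀ u v → u ∈ₛ Q → v ∈ₛ Q → u ≢ v → Adj u v

  IsMaximalClique : Subset n → Set
  IsMaximalClique Q = IsClique Q × (∀ Q′ → IsClique Q′ → Q ⊆ Q′ → Q′ ⊆ Q)

  -- Interval graph: vertices can be assigned closed intervals [l v, r v]
  -- (integer endpoints suffice for finite graphs) such that two distinct
  -- vertices are adjacent iff their intervals intersect.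
  IsIntervalGraph : Set
  IsIntervalGraph =
    Σ (Fin n → ℕ) λ l → Σ (Fin n → ℕ) λ r →
      (∀ v → l v ≤ r v) ×
      (∀ u v → u ≢ v → (Adj u v ⇔ (l u ≤ r v × l v ≤ r u)))

  IsCliqueSequence : List (Subset n) → Set
  IsCliqueSequence S = All IsClique S

  Consecutive : Fin n → List (Subset n) → Set
  Consecutive v S = ∀ (i j k : Fin (length S)) → i Fin.≤ j → j Fin.≤ k →
    v ∈ₛ lookup S i → v ∈ₛ lookup S k → v ∈ₛ lookup S j

  IsCliqueOrdering : List (Subset n) → Set
  IsCliqueOrdering S =
    IsCliqueSequence S ×
    (∀ Q → IsMaximalClique Q → Q ∈ₗ S) ×
    (∀ v → Consecutive v S)

data PQTree (A : Set) : Set where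
  leaf  : A → PQTree A
  pnode : List (PQTree A) → PQTree A
  qnode : List (PQTree A) → PQTree A

module _ {A : Set} where

  mutual
    frontier : PQTree A → List A
    frontier (leaf a)   = a ∷ []
    frontier (pnode ts) = frontiers ts
    frontier (qnode ts) = frontiers ts

    frontiers : List (PQTree A) → List A
    frontiers []       = []
    frontiers (t ∷ ts) = frontier t ++ frontiers ts

  -- Well-formedness: every internal node has at least two children
  -- (a node with exactly two children is regarded as a Q-node; this
  -- has no effect on the set of leaf orders).
  mutual
    data WF : PQTree A → Set where
      wf-leaf  : ∀ a → WF (leaf a)
      wf-pnode : ∀ t₁ t₂ ts → WFs (t₁ ∷ t₂ ∷ ts) → WF (pnode (t₁ ∷ t₂ ∷ ts))
      wf-qnode : ∀ t₁ t₂ ts → WFs (t₁ ∷ t₂ ∷ ts) → WF (qnode (t₁ ∷ t₂ ∷ ts))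

    data WFs : List (PQTree A) → Set where
      []  : WFs []
      _∷_ : ∀ {t ts} → WF t → WFs ts → WFs (t ∷ ts)

  mutual
    data LeafOrder : PQTree A → List A → Set where
      lo-leaf  : ∀ a → LeafOrder (leaf a) (a ∷ [])
      lo-pnode : ∀ {ts xs} ts′ → ts ↭ ts′ → LeafOrders ts′ xs →
                 LeafOrder (pnode ts) xs
      lo-qnode : ∀ {ts xs} → LeafOrders ts xs → LeafOrder (qnode ts) xs
      lo-qrev  : ∀ {ts xs} → LeafOrders (reverse ts) xs →
                 LeafOrder (qnode ts) xs

    data LeafOrders : List (PQTree A) → List A → Set where
      []  : LeafOrders [] []
      _∷_ : ∀ {t ts xs ys} → LeafOrder t xs → LeafOrders ts ys →
            LeafOrders (t ∷ ts) (xs ++ ys)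

module _ (G : Graph) where
  open Graph G

  lastOr∅ : List (Subset n) → Subset n
  lastOr∅ []           = ∅
  lastOr∅ (Q ∷ [])     = Q
  lastOr∅ (_ ∷ Q ∷ Qs) = lastOr∅ (Q ∷ Qs)

  headOr∅ : List (Subset n) → Subset n
  headOr∅ []      = ∅
  headOr∅ (Q ∷ _) = Q

  -- One subclique insertion: S = pre ++ post becomes pre ++ Q′ ∷ post,
  -- where (with Qᵢ = last of pre, Qᵢ₊₁ = head of post, ∅ if absent)
  -- Q′ is a clique of G, Qᵢ ∩ Qᵢ₊₁ ⊆ Q′, and Q′ ⊆ Qᵢ or Q′ ⊆ Qᵢ₊₁.
  data SubcliqueInsertion : List (Subset n) → List (Subset n) → Set where
    insert : ∀ pre post Q′ →
      IsClique G Q′ →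
      (lastOr∅ pre ∩ headOr∅ post) ⊆ Q′ →
      (Q′ ⊆ lastOr∅ pre ⊎ Q′ ⊆ headOr∅ post) →
      SubcliqueInsertion (pre ++ post) (pre ++ Q′ ∷ post)

  GeneratedBy : PQTree (Subset n) → List (Subset n) → Set
  GeneratedBy T S =
    ∃[ L ] (LeafOrder T L × Star SubcliqueInsertion L S)

  IsMaxCliqueArrangement : List (Subset n) → Set
  IsMaxCliqueArrangement L =
    Unique L × (∀ Q → (Q ∈ₗ L ⇔ IsMaximalClique G Q))

  IsPQTreeOf : PQTree (Subset n) → Set
  IsPQTreeOf T =
    WF T ×
    IsMaxCliqueArrangement (frontier T) ×
    (∀ L → (LeafOrder T L ⇔ (IsMaxCliqueArrangement L × (∀ v → Consecutive G v L))))

-- A subclique insertion never deletes an entry, and the conditions it imposes on the new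
-- clique Q′ (containing Qᵢ ∩ Qᵢ₊₁, contained in Qᵢ or Qᵢ₊₁) are exactly what keeps the
-- entries containing any given vertex consecutive; so everything generated from a leaf
-- order of the PQ-tree is a clique ordering.
-- Conversely, an entry X of a clique ordering that is contained in another entry Y can be
-- deleted: the rest is still a clique ordering, and consecutiveness forces X to contain the
-- intersection of its two neighbours and to lie inside the neighbour on Y's side, so X is
-- put back by a subclique insertion. Deleting such entries until none is left, every
-- remaining entry is maximal (a maximal clique containing it occurs too, and can only be the
-- entry itself), and no entry repeats: the result is an ordering of the maximal cliques with
-- consecutive occurrences, i.e. a leaf order.

module Submission where

open import Defs
open import Data.Fin.Subset using (Subset)
open import Data.List using (List)
open import Function.Bundles using (_⇔_)

open import Data.Nat using (_<_; s≤s; z≤n; _≤?_)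
open import Data.Nat.Properties using (≤-reflexive)
open import Data.Nat.Induction using (<-wellFounded)
open import Data.Fin as Fin using (Fin; zero; suc)
open import Data.Fin.Properties using (any?; all?)
open import Data.Fin.Subset using (_⊆_; _∩_; _∪_; ⁅_⁆; _⊃_) renaming (_∈_ to _∈ₛ_; _∉_ to _∉ₛ_)
open import Data.Fin.Subset.Properties
  using ( _∈?_; _⊆?_; ∉⊥; x∈p∩q⁺; x∈p∩q⁻; x∈p∪q⁻; p⊆p∪q; q⊆p∪q; x∈⁅x⁆; x∈⁅y⁆⇒x≡y
        ; ⊆-antisym; ⊆-reflexive)
open import Data.Fin.Subset.Induction using (⊃-wellFounded)
open import Data.List using ([]; _∷_; _++_; [_]; length; lookup; head; last)
open import Data.List.Properties using (++-assoc; length-++-sucʳ)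
open import Data.List.Relation.Unary.All as All using (All; []; _∷_)
import Data.List.Relation.Unary.All.Properties as Allₚ
open import Data.List.Relation.Unary.Any as Any using (Any; here; there)
open import Data.List.Relation.Unary.Any.Properties using (++⁺ʳ; ++⁻)
open import Data.List.Relation.Unary.Unique.Propositional using (Unique)
open import Data.List.Relation.Unary.AllPairs using ([]; _∷_)
open import Data.List.Membership.Propositional using (_∈_; lose; find)
open import Data.List.Membership.Propositional.Properties using (∈-lookup; ∈-++⁻; ∈-++⁺ˡ; ∈-++⁺ʳ; ∈-∃++)
open import Data.Maybe.Relation.Unary.Any as Maybe using (just)
open import Data.Product using (Σ; ∃; _×_; _,_; proj₁; uncurry)
open import Data.Sum as Sum using (_⊎_; inj₁; inj₂)
open import Data.Empty using (⊥-elim)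
open import Function using (id; _∘_)
open import Function.Bundles using (mk⇔; module Equivalence)
open import Induction.WellFounded using (Acc; acc)
open import Relation.Binary using () renaming (Decidable to Decidable₂)
open import Relation.Binary.PropositionalEquality using (_≡_; _≢_; refl; sym; trans; subst)
open import Relation.Binary.Construct.Closure.ReflexiveTransitive using (Star; ε; _◅_; _◅◅_)
open import Relation.Nullary using (¬_; Dec; yes; no)
open import Relation.Nullary.Decidable using (map′; ¬?; _×-dec_; _→-dec_; decidable-stable)
open import Relation.Unary using (Decidable)

open Equivalence using (to; from)

data Phase : Set where
  before during after : Phase

leave : Phase → Phase
leave before = before
leave during = after
leave after  = after

data Enterable : Phase → Set where
  before : Enterable before
  during : Enterable during

module Contiguity {A : Set} (P : A → Set) where

  -- A run of the automaton accepting the words ¬P* P* ¬P*, started in a given phase.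
  data Contiguous : Phase → List A → Set where
    []   : ∀ {s} → Contiguous s []
    hit  : ∀ {s x xs} → Enterable s → P x → Contiguous during xs → Contiguous s (x ∷ xs)
    miss : ∀ {s x xs} → ¬ P x → Contiguous (leave s) xs → Contiguous s (x ∷ xs)

  Convex : List A → Set
  Convex xs = ∀ (i j k : Fin (length xs)) → i Fin.≤ j → j Fin.≤ k →
    P (lookup xs i) → P (lookup xs k) → P (lookup xs j)

  after⇒during : ∀ {xs} → Contiguous after xs → Contiguous during xs
  after⇒during []           = []
  after⇒during (miss ¬px r) = miss ¬px r

  during⇒before : ∀ {xs} → Contiguous during xs → Contiguous before xs
  during⇒before []           = []
  during⇒before (hit _ px r) = hit before px r
  during⇒before (miss ¬px r) = miss ¬px (during⇒before (after⇒during r))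

  after⇒¬Any : ∀ {xs} → Contiguous after xs → ¬ Any P xs
  after⇒¬Any (miss ¬px r) (here px)  = ¬px px
  after⇒¬Any (miss ¬px r) (there pxs) = after⇒¬Any r pxs

  tail : ∀ {s x xs} → Contiguous s (x ∷ xs) → Σ Phase λ s′ → Contiguous s′ xs
  tail (hit _ _ r) = during , r
  tail (miss _ r)  = _ , r

  drop : ∀ {s} pre {xs} → Contiguous s (pre ++ xs) → Σ Phase λ s′ → Contiguous s′ xs
  drop []        r = _ , r
  drop (_ ∷ pre) r with s′ , r′ ← tail r = drop pre r′

  during-downward : ∀ {xs} → Contiguous during xs → (j k : Fin (length xs)) → j Fin.≤ k →
    P (lookup xs k) → P (lookup xs j)
  during-downward (hit _ px r)  zero    k       _         _   = px
  during-downward (hit _ px r)  (suc j) (suc k) (s≤s j≤k) pxk = during-downward r j k j≤k pxk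
  during-downward (miss ¬px r)  zero    zero    _         pxk = pxk
  during-downward (miss ¬px r)  j       (suc k) _         pxk = ⊥-elim (after⇒¬Any r (lose (∈-lookup k) pxk))

  contiguous⇒convex : ∀ {s xs} → Contiguous s xs → Convex xs
  contiguous⇒convex (hit _ px r) i       zero    k       _         _         _   _   = px
  contiguous⇒convex (hit _ px r) i       (suc j) (suc k) _         (s≤s j≤k) _   pxk =
    during-downward r j k j≤k pxk
  contiguous⇒convex (miss ¬px r) zero    j       k       _         _         pxi _   = ⊥-elim (¬px pxi)
  contiguous⇒convex (miss ¬px r) (suc i) (suc j) (suc k) (s≤s i≤j) (s≤s j≤k) pxi pxk =
    contiguous⇒convex r i j k i≤j j≤k pxi pxk

  module _ (P? : Decidable P) where

    convex-tail : ∀ {x xs} → Convex (x ∷ xs) → Convex xs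
    convex-tail c i j k i≤j j≤k = c (suc i) (suc j) (suc k) (s≤s i≤j) (s≤s j≤k)

    none⇒after : ∀ {xs} → (∀ k → ¬ P (lookup xs k)) → Contiguous after xs
    none⇒after {[]}     _  = []
    none⇒after {x ∷ xs} ¬p = miss (¬p zero) (none⇒after (λ k → ¬p (suc k)))

    convex⇒during : ∀ {x xs} → Convex (x ∷ xs) → P x → Contiguous during xs
    convex⇒during {xs = []}     c px = []
    convex⇒during {xs = y ∷ ys} c px with P? y
    ... | yes py = hit during py (convex⇒during (convex-tail c) py)
    ... | no ¬py = miss ¬py (none⇒after λ k pk →
                     ¬py (c zero (suc zero) (suc (suc k)) z≤n (s≤s z≤n) px pk))

    convex⇒contiguous : ∀ {xs} → Convex xs → Contiguous before xs
    convex⇒contiguous {[]}     c = []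
    convex⇒contiguous {x ∷ xs} c with P? x
    ... | yes px = hit before px (convex⇒during c px)
    ... | no ¬px = miss ¬px (convex⇒contiguous (convex-tail c))

  map-tail : ∀ {s x xs ys} → (∀ {s} → Contiguous s xs → Contiguous s ys) →
    Contiguous s (x ∷ xs) → Contiguous s (x ∷ ys)
  map-tail f (hit e px r) = hit e px (f r)
  map-tail f (miss ¬px r) = miss ¬px (f r)

  remove : ∀ {s} pre {x} post → Contiguous s (pre ++ x ∷ post) → Contiguous s (pre ++ post)
  remove {before} [] post (hit _ _ r) = during⇒before r
  remove {during} [] post (hit _ _ r) = r
  remove {before} [] post (miss _ r)  = r
  remove {during} [] post (miss _ r)  = after⇒during r
  remove {after}  [] post (miss _ r)  = r
  remove (_ ∷ pre) post r = map-tail (remove pre post) r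

  during⇒All : ∀ xs {ys} → Contiguous during (xs ++ ys) → Any P ys → All P xs
  during⇒All []       r            _   = []
  during⇒All (x ∷ xs) (hit _ px r) pys = px ∷ during⇒All xs r pys
  during⇒All (x ∷ xs) (miss _ r)   pys = ⊥-elim (after⇒¬Any r (++⁺ʳ xs pys))

  during⇒head : ∀ {xs} → Contiguous during xs → Any P xs → Maybe.Any P (head xs)
  during⇒head (hit _ px _) _           = just px
  during⇒head (miss ¬px _) (here px)   = ⊥-elim (¬px px)
  during⇒head (miss _ r)   (there pxs) = ⊥-elim (after⇒¬Any r pxs)

  All⇒last : ∀ {x xs} → All P (x ∷ xs) → Maybe.Any P (last (x ∷ xs))
  All⇒last (px ∷ [])          = just px
  All⇒last (_ ∷ pxs@(_ ∷ _)) = All⇒last pxs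

  head⇒Any : ∀ {xs} → Maybe.Any P (head xs) → Any P xs
  head⇒Any {_ ∷ _} (just px) = here px

  last⇒Any : ∀ {xs} → Maybe.Any P (last xs) → Any P xs
  last⇒Any {_ ∷ []}    (just px) = here px
  last⇒Any {_ ∷ _ ∷ _} p        = there (last⇒Any p)

  during⇒hit : ∀ pre {x post} → Contiguous during (pre ++ x ∷ post) → Any P post → P x
  during⇒hit []        (hit _ px _) _   = px
  during⇒hit []        (miss _ r)   pps = ⊥-elim (after⇒¬Any r pps)
  during⇒hit (_ ∷ pre) (hit _ _ r)  pps = during⇒hit pre r pps
  during⇒hit (_ ∷ pre) (miss _ r)   pps = ⊥-elim (after⇒¬Any r (++⁺ʳ pre (there pps)))

  between-hits : ∀ {s} pre {x post} → Contiguous s (pre ++ x ∷ post) →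
    Any P pre → Any P post → P x
  between-hits (_ ∷ pre) (hit _ _ r) (here _)   pps = during⇒hit pre r pps
  between-hits (_ ∷ _)   (miss ¬pp _) (here pp) _   = ⊥-elim (¬pp pp)
  between-hits (_ ∷ pre) r (there ppre) pps with _ , r′ ← tail r = between-hits pre r′ ppre pps

  hit-before⇒last : ∀ {s} pre {x post} → Contiguous s (pre ++ x ∷ post) →
    Any P pre → P x → Maybe.Any P (last pre)
  hit-before⇒last (_ ∷ pre) (hit _ pp r) (here _) px = All⇒last (pp ∷ during⇒All pre r (here px))
  hit-before⇒last (_ ∷ _)   (miss ¬pp _) (here pp) _ = ⊥-elim (¬pp pp)
  hit-before⇒last (_ ∷ pre@(_ ∷ _)) r (there ppre) px with _ , r′ ← tail r =
    hit-before⇒last pre r′ ppre px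

  hit-after⇒head : ∀ {s} pre {x post} → Contiguous s (pre ++ x ∷ post) →
    Any P post → P x → Maybe.Any P (head post)
  hit-after⇒head pre r pps px with drop pre r
  ... | _ , hit _ _ r′ = during⇒head r′ pps
  ... | _ , miss ¬px _ = ⊥-elim (¬px px)

  during⇒after : ∀ {xs} → Contiguous during xs → ¬ Maybe.Any P (head xs) → Contiguous after xs
  during⇒after []           _  = []
  during⇒after (hit _ px _) ¬h = ⊥-elim (¬h (just px))
  during⇒after (miss ¬px r) _  = miss ¬px r

  leave-idem : ∀ {s xs} → Contiguous (leave s) xs → Contiguous (leave (leave s)) xs
  leave-idem {before} r = r
  leave-idem {during} r = r
  leave-idem {after}  r = r

  insert-hit-after : ∀ {s} pre {q post} → Maybe.Any P (last pre) → P q →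
    Contiguous s (pre ++ post) → Contiguous s (pre ++ q ∷ post)
  insert-hit-after (_ ∷ [])         _         pq (hit e pp r) = hit e pp (hit during pq r)
  insert-hit-after (_ ∷ [])         (just pp) _  (miss ¬pp _) = ⊥-elim (¬pp pp)
  insert-hit-after (_ ∷ pre@(_ ∷ _)) pl       pq r            = map-tail (insert-hit-after pre pl pq) r

  insert-hit-before : ∀ {s} pre {q post} → Maybe.Any P (head post) → P q →
    Contiguous s (pre ++ post) → Contiguous s (pre ++ q ∷ post)
  insert-hit-before []        _         pq (hit e ph r) = hit e pq (hit during ph r)
  insert-hit-before []        (just ph) _  (miss ¬ph _) = ⊥-elim (¬ph ph)
  insert-hit-before (_ ∷ pre) ph        pq r            = map-tail (insert-hit-before pre ph pq) r

  insert-miss-∷ : ∀ {s} p pre {q post} → ¬ P q →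
    (Maybe.Any P (last (p ∷ pre)) → ¬ Maybe.Any P (head post)) →
    Contiguous s (p ∷ pre ++ post) → Contiguous s (p ∷ pre ++ q ∷ post)
  insert-miss-∷ _ []         ¬pq gap (hit e pp r) = hit e pp (miss ¬pq (during⇒after r (gap (just pp))))
  insert-miss-∷ _ []         ¬pq gap (miss ¬pp r) = miss ¬pp (miss ¬pq (leave-idem r))
  insert-miss-∷ _ (p ∷ pre)  ¬pq gap r            = map-tail (insert-miss-∷ p pre ¬pq gap) r

  insert-miss : ∀ pre {q post} → ¬ P q → (Maybe.Any P (last pre) → ¬ Maybe.Any P (head post)) →
    Contiguous before (pre ++ post) → Contiguous before (pre ++ q ∷ post)
  insert-miss []        ¬pq _   r = miss ¬pq r
  insert-miss (p ∷ pre) ¬pq gap r = insert-miss-∷ p pre ¬pq gap r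

  insert-contiguous : Decidable P → ∀ pre {q post} →
    (Maybe.Any P (last pre) → Maybe.Any P (head post) → P q) →
    (P q → Maybe.Any P (last pre)) ⊎ (P q → Maybe.Any P (head post)) →
    Contiguous before (pre ++ post) → Contiguous before (pre ++ q ∷ post)
  insert-contiguous P? pre {q} fill adjacent r with P? q | adjacent
  ... | yes pq | inj₁ toLast = insert-hit-after pre (toLast pq) pq r
  ... | yes pq | inj₂ toHead = insert-hit-before pre (toHead pq) pq r
  ... | no ¬pq | _           = insert-miss pre ¬pq (λ pl ph → ¬pq (fill pl ph)) r

Dominated : {A : Set} → (A → A → Set) → List A → List A → Set
Dominated R ctx xs =
  ∃ λ pre → ∃ λ x → ∃ λ post → xs ≡ pre ++ x ∷ post × Any (R x) (ctx ++ pre ++ post)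

module _ {A : Set} {R : A → A → Set} where

  dominated? : Decidable₂ R → ∀ ctx xs → Dec (Dominated R ctx xs)
  dominated? R? ctx []       = no λ where
    ([]    , _ , _ , () , _)
    (_ ∷ _ , _ , _ , () , _)
  dominated? R? ctx (x ∷ xs) with Any.any? (R? x) (ctx ++ xs)
  ... | yes below = yes ([] , x , xs , refl , below)
  ... | no ¬below with dominated? R? (ctx ++ [ x ]) xs
  ...   | yes (pre , y , post , refl , below) =
          yes (x ∷ pre , y , post , refl , subst (Any (R y)) (++-assoc ctx [ x ] (pre ++ post)) below)
  ...   | no ¬dominated = no λ where
          ([] , _ , _ , refl , below) → ¬below below
          (_ ∷ pre , y , post , refl , below) →
            ¬dominated (pre , y , post , refl , subst (Any (R y)) (sym (++-assoc ctx [ x ] (pre ++ post))) below)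

  ¬dominated-tail : ∀ {x xs} → ¬ Dominated R [] (x ∷ xs) → ¬ Dominated R [] xs
  ¬dominated-tail {x} ¬d (pre , y , post , refl , below) = ¬d (x ∷ pre , y , post , refl , there below)

module _ {A : Set} where

  ∈-insert : ∀ pre {y x : A} {post} → y ∈ pre ++ post → y ∈ pre ++ x ∷ post
  ∈-insert pre m with ∈-++⁻ pre m
  ... | inj₁ m′ = ∈-++⁺ˡ m′
  ... | inj₂ m′ = ∈-++⁺ʳ pre (there m′)

  ∈-remove : ∀ pre {y x : A} {post} → y ∈ pre ++ x ∷ post → y ≡ x ⊎ y ∈ pre ++ post
  ∈-remove pre m with ∈-++⁻ pre m
  ... | inj₁ m′         = inj₂ (∈-++⁺ˡ m′)
  ... | inj₂ (here eq)  = inj₁ eq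
  ... | inj₂ (there m′) = inj₂ (∈-++⁺ʳ pre m′)

module _ (G : Graph) (adjacent? : Decidable₂ (Graph.Adj G)) where
  open Graph G using (n; Adj)

  Extends : Subset n → Fin n → Set
  Extends X w = w ∉ₛ X × (∀ u → u ∈ₛ X → u ≢ w → Adj u w)

  extends? : ∀ X w → Dec (Extends X w)
  extends? X w = ¬? (w ∈? X) ×-dec all? λ u → u ∈? X →-dec ¬? (u Fin.≟ w) →-dec adjacent? u w

  clique-∪-⁅⁆ : ∀ {X w} → IsClique G X → (∀ u → u ∈ₛ X → u ≢ w → Adj u w) → IsClique G (X ∪ ⁅ w ⁆)
  clique-∪-⁅⁆ {X} {w} clique adj u u′ u∈ u′∈ u≢u′ with x∈p∪q⁻ X ⁅ w ⁆ u∈ | x∈p∪q⁻ X ⁅ w ⁆ u′∈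
  ... | inj₁ u∈X | inj₁ u′∈X = clique u u′ u∈X u′∈X u≢u′
  ... | inj₁ u∈X | inj₂ u′∈w with refl ← x∈⁅y⁆⇒x≡y w u′∈w = adj u u∈X u≢u′
  ... | inj₂ u∈w | inj₁ u′∈X with refl ← x∈⁅y⁆⇒x≡y w u∈w = Graph.sym G (adj u′ u′∈X (u≢u′ ∘ sym))
  ... | inj₂ u∈w | inj₂ u′∈w =
    ⊥-elim (u≢u′ (trans (x∈⁅y⁆⇒x≡y w u∈w) (sym (x∈⁅y⁆⇒x≡y w u′∈w))))

  unextendable⇒maximal : ∀ {X} → IsClique G X → ¬ ∃ (Extends X) → IsMaximalClique G X
  unextendable⇒maximal {X} clique stuck = clique , λ Q′ clique′ X⊆Q′ {w} w∈Q′ →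
    decidable-stable (w ∈? X) λ w∉X →
      stuck (w , w∉X , λ u u∈X u≢w → clique′ u w (X⊆Q′ u∈X) w∈Q′ u≢w)

  extend : ∀ X → IsClique G X → Acc _⊃_ X → ∃ λ M → IsMaximalClique G M × X ⊆ M
  extend X clique (acc larger) with any? (extends? X)
  ... | no stuck = X , unextendable⇒maximal clique stuck , id
  ... | yes (w , w∉X , adj)
    with M , max , X∪w⊆M ← extend (X ∪ ⁅ w ⁆) (clique-∪-⁅⁆ clique adj)
                              (larger (p⊆p∪q _ , w , q⊆p∪q X _ (x∈⁅x⁆ w) , w∉X))
    = M , max , X∪w⊆M ∘ p⊆p∪q _

  maximal-extension : ∀ X → IsClique G X → ∃ λ M → IsMaximalClique G M × X ⊆ M
  maximal-extension X clique = extend X clique (⊃-wellFounded X)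

module CliqueOrderings (G : Graph) where
  open Graph G using (n; Adj)
  open Contiguity

  module _ {v : Fin n} where

    ∈-headOr∅⇔ : ∀ xs → v ∈ₛ headOr∅ G xs ⇔ Maybe.Any (v ∈ₛ_) (head xs)
    ∈-headOr∅⇔ []      = mk⇔ (λ v∈∅ → ⊥-elim (∉⊥ v∈∅)) λ ()
    ∈-headOr∅⇔ (_ ∷ _) = mk⇔ just Maybe.drop-just

    ∈-lastOr∅⇔ : ∀ xs → v ∈ₛ lastOr∅ G xs ⇔ Maybe.Any (v ∈ₛ_) (last xs)
    ∈-lastOr∅⇔ []           = mk⇔ (λ v∈∅ → ⊥-elim (∉⊥ v∈∅)) λ ()
    ∈-lastOr∅⇔ (_ ∷ [])     = mk⇔ just Maybe.drop-just
    ∈-lastOr∅⇔ (_ ∷ x ∷ xs) = ∈-lastOr∅⇔ (x ∷ xs)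

  ordering-contiguous : ∀ {S} → IsCliqueOrdering G S → ∀ v → Contiguous (v ∈ₛ_) before S
  ordering-contiguous (_ , _ , consecutive) v = convex⇒contiguous _ (v ∈?_) (consecutive v)

  insertion-preserves-ordering : ∀ {L S} → SubcliqueInsertion G L S →
    IsCliqueOrdering G L → IsCliqueOrdering G S
  insertion-preserves-ordering (insert pre post Q′ clique ∩⊆Q′ Q′⊆) ord@(cliques , maximal∈ , _) =
      Allₚ.++⁺ (Allₚ.++⁻ˡ pre cliques) (clique ∷ Allₚ.++⁻ʳ pre cliques)
    , (λ Q max → ∈-insert pre (maximal∈ Q max))
    , λ v → contiguous⇒convex _
              (insert-contiguous _ (v ∈?_) pre (fill v) (adjacent v) (ordering-contiguous ord v))
    where
    fill : ∀ v → Maybe.Any (v ∈ₛ_) (last pre) → Maybe.Any (v ∈ₛ_) (head post) → v ∈ₛ Q′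
    fill v v∈last v∈head = ∩⊆Q′ (x∈p∩q⁺ (from (∈-lastOr∅⇔ pre) v∈last , from (∈-headOr∅⇔ post) v∈head))

    adjacent : ∀ v → (v ∈ₛ Q′ → Maybe.Any (v ∈ₛ_) (last pre))
                   ⊎ (v ∈ₛ Q′ → Maybe.Any (v ∈ₛ_) (head post))
    adjacent v = Sum.map (λ Q′⊆last v∈Q′ → to (∈-lastOr∅⇔ pre) (Q′⊆last v∈Q′))
                         (λ Q′⊆head v∈Q′ → to (∈-headOr∅⇔ post) (Q′⊆head v∈Q′)) Q′⊆

  maximal-⊆-clique⇒≡ : ∀ {X Y} → IsMaximalClique G X → IsClique G Y → X ⊆ Y → X ≡ Y
  maximal-⊆-clique⇒≡ (_ , maximal) clique X⊆Y = ⊆-antisym X⊆Y (maximal _ clique X⊆Y)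

  removal-preserves-ordering : ∀ pre {X} post → IsCliqueOrdering G (pre ++ X ∷ post) →
    Any (X ⊆_) (pre ++ post) → IsCliqueOrdering G (pre ++ post)
  removal-preserves-ordering pre post ord@(cliques , maximal∈ , _) below =
    cliques′ , maximal∈′ , λ v → contiguous⇒convex _ (remove _ pre post (ordering-contiguous ord v))
    where
    cliques′ : All (IsClique G) (pre ++ post)
    cliques′ with cl₁ , _ ∷ cl₂ ← Allₚ.++⁻ pre cliques = Allₚ.++⁺ cl₁ cl₂

    maximal∈′ : ∀ Q → IsMaximalClique G Q → Q ∈ pre ++ post
    maximal∈′ Q max with ∈-remove pre (maximal∈ Q max)
    ... | inj₂ Q∈ = Q∈
    ... | inj₁ refl with Y , Y∈ , Q⊆Y ← find below =
      subst (_∈ pre ++ post) (sym (maximal-⊆-clique⇒≡ max (All.lookup cliques′ Y∈) Q⊆Y)) Y∈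

  reinsertion : ∀ pre {X} post → IsCliqueOrdering G (pre ++ X ∷ post) →
    Any (X ⊆_) (pre ++ post) → SubcliqueInsertion G (pre ++ post) (pre ++ X ∷ post)
  reinsertion pre {X} post ord@(cliques , _) below =
    insert pre post X (All.head (Allₚ.++⁻ʳ pre cliques)) fill adjacent
    where
    fill : lastOr∅ G pre ∩ headOr∅ G post ⊆ X
    fill {v} v∈∩ with v∈last , v∈head ← x∈p∩q⁻ _ _ v∈∩ =
      between-hits _ pre (ordering-contiguous ord v)
        (last⇒Any _ (to (∈-lastOr∅⇔ pre) v∈last)) (head⇒Any _ (to (∈-headOr∅⇔ post) v∈head))

    adjacent : X ⊆ lastOr∅ G pre ⊎ X ⊆ headOr∅ G post
    adjacent with ++⁻ pre below
    ... | inj₁ inPre  = inj₁ λ {v} v∈X → from (∈-lastOr∅⇔ pre)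
            (hit-before⇒last _ pre (ordering-contiguous ord v) (Any.map (λ X⊆Y → X⊆Y v∈X) inPre) v∈X)
    ... | inj₂ inPost = inj₂ λ {v} v∈X → from (∈-headOr∅⇔ post)
            (hit-after⇒head _ pre (ordering-contiguous ord v) (Any.map (λ X⊆Y → X⊆Y v∈X) inPost) v∈X)

  star-preserves-ordering : ∀ {L S} → Star (SubcliqueInsertion G) L S →
    IsCliqueOrdering G L → IsCliqueOrdering G S
  star-preserves-ordering ε           ord = ord
  star-preserves-ordering (ins ◅ ins*) ord =
    star-preserves-ordering ins* (insertion-preserves-ordering ins ord)

  Irredundant : List (Subset n) → Set
  Irredundant L = ¬ Dominated _⊆_ [] L

  irredundant-generator : ∀ {S} → IsCliqueOrdering G S → Acc _<_ (length S) →
    ∃ λ L → Irredundant L × IsCliqueOrdering G L × Star (SubcliqueInsertion G) L S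
  irredundant-generator {S} ord (acc shorter) with dominated? _⊆?_ [] S
  ... | no irredundant = S , irredundant , ord , ε
  ... | yes (pre , X , post , refl , below)
    with L , irredundant , ordL , L⇝ ← irredundant-generator (removal-preserves-ordering pre post ord below)
                                         (shorter (≤-reflexive (sym (length-++-sucʳ pre X post))))
    = L , irredundant , ordL , L⇝ ◅◅ (reinsertion pre post ord below ◅ ε)

  irredundant⇒unique : ∀ {L} → Irredundant L → Unique L
  irredundant⇒unique {[]}     _   = []
  irredundant⇒unique {x ∷ xs} irr =
    All.tabulate (λ y∈xs x≡y → irr ([] , x , xs , refl , lose y∈xs (⊆-reflexive x≡y)))
    ∷ irredundant⇒unique (¬dominated-tail irr)

  irredundant⇒maximal : Decidable₂ Adj → ∀ {L} → IsCliqueOrdering G L → Irredundant L →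
    ∀ {Q} → Q ∈ L → IsMaximalClique G Q
  irredundant⇒maximal adjacent? (cliques , maximal∈ , _) irr {Q} Q∈
    with M , max , Q⊆M ← maximal-extension G adjacent? Q (All.lookup cliques Q∈)
       | pre , post , refl ← ∈-∃++ Q∈
    with ∈-remove pre (maximal∈ M max)
  ... | inj₁ refl = max
  ... | inj₂ M∈   = ⊥-elim (irr (pre , Q , post , refl , lose M∈ Q⊆M))

  irredundant⇒arrangement : Decidable₂ Adj → ∀ {L} → IsCliqueOrdering G L → Irredundant L →
    IsMaxCliqueArrangement G L
  irredundant⇒arrangement adjacent? ord@(_ , maximal∈ , _) irr =
    irredundant⇒unique irr , λ Q → mk⇔ (irredundant⇒maximal adjacent? ord irr) (maximal∈ Q)

  arrangement⇒ordering : ∀ {L} → IsMaxCliqueArrangement G L → (∀ v → Consecutive G v L) →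
    IsCliqueOrdering G L
  arrangement⇒ordering (_ , ∈⇔maximal) consecutive =
    All.tabulate (λ {Q} Q∈ → proj₁ (to (∈⇔maximal Q) Q∈)) , (λ Q → from (∈⇔maximal Q)) , consecutive

interval⇒adjacent? : (G : Graph) → IsIntervalGraph G → Decidable₂ (Graph.Adj G)
interval⇒adjacent? G (l , r , _ , adjacent⇔) u v with u Fin.≟ v
... | yes refl = no (Graph.irrefl G)
... | no u≢v   =
  map′ (from (adjacent⇔ u v u≢v)) (to (adjacent⇔ u v u≢v)) (l u ≤? r v ×-dec l v ≤? r u)

lemma1 : (G : Graph) → IsIntervalGraph G →
    (T : PQTree (Subset (Graph.n G))) → IsPQTreeOf G T →
    (S : List (Subset (Graph.n G))) → IsCliqueSequence G S →
    (IsCliqueOrdering G S ⇔ GeneratedBy G T S)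
lemma1 G interval T (_ , _ , leafOrder⇔) S _ = mk⇔ ordering⇒generated generated⇒ordering
  where
  open CliqueOrderings G

  ordering⇒generated : IsCliqueOrdering G S → GeneratedBy G T S
  ordering⇒generated ord
    with L , irredundant , ordL@(_ , _ , consecutive) , L⇝S ← irredundant-generator ord (<-wellFounded _)
    = L , from (leafOrder⇔ L) (arrangement , consecutive) , L⇝S
    where
    arrangement : IsMaxCliqueArrangement G L
    arrangement = irredundant⇒arrangement (interval⇒adjacent? G interval) ordL irredundant

  generated⇒ordering : GeneratedBy G T S → IsCliqueOrdering G S
  generated⇒ordering (L , leafOrder , L⇝S) =
    star-preserves-ordering L⇝S (uncurry arrangement⇒ordering (to (leafOrder⇔ L) leafOrder))
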